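{- Let $H$ be an ordered graph such that $g_H(n)=\omega(\log n)$. Then $H$ has maximum degree at most 1.
   Context: An ordered graph is a graph with a total order on its vertex set. For a graph $G$ with a Hamiltonian path $P=v_1,\dots,v_n$, $(G,P)$ contains the ordered graph $H$ (order $u_1,\dots,u_k$) as a pattern if there exist $1\le a_1<\dots<a_k\le n$ such that every edge $u_iu_j$ of $H$ maps to an edge $v_{a_i}v_{a_j}$ of $G-E(P)$; otherwise $(G,P)$ avoids $H$. $g_H(n)$ is the maximum integer $t$ such that for every graph $G$ with a Hamiltonian path $P$ on $n$ vertices, if $(G,P)$ avoids $H$ then $G$ contains an induced path on at least $t$ vertices. -}

module Defs where

open import Data.Nat using (ℕ; suc; _≤_; _*_)
open import Data.Nat.Logarithm using (⌊log₂_⌋)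
open import Data.Fin using (Fin; toℕ; _<_)
open import Data.Bool using (Bool; true; false)
open import Data.Product using (Σ; _×_; ∃; ∃-syntax)
open import Data.Sum using (_⊎_)
open import Data.Empty using (⊥)
open import Relation.Binary.PropositionalEquality using (_≡_; _≢_)
open import Function.Definitions using (Injective)

-- A finite simple graph on vertex set Fin n (Bool-valued adjacency,
-- symmetric and irreflexive).  An ordered graph is such a graph where the
-- vertex order is the natural order on Fin n.
record Graph (n : ℕ) : Set where
  field
    adj   : Fin n → Fin n → Bool
    sym   : ∀ u v → adj u v ≡ adj v u
    irrefl : ∀ u → adj u u ≡ false
open Graph public

Consecutive : ∀ {n} → Fin n → Fin n → Set
Consecutive i j = (toℕ j ≡ suc (toℕ i)) ⊎ (toℕ i ≡ suc (toℕ j))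

-- P : Fin n → Fin n lists the vertices v_1,…,v_n (P i = v_{i+1}) of a
-- Hamiltonian path of G: every vertex occurs exactly once (P injective on
-- Fin n, hence a bijection) and consecutive vertices are adjacent.
IsHamPath : ∀ {n} → Graph n → (Fin n → Fin n) → Set
IsHamPath {n} G P =
  Injective _≡_ _≡_ P ×
  (∀ (i j : Fin n) → toℕ j ≡ suc (toℕ i) → adj G (P i) (P j) ≡ true)

-- (G , P) contains the ordered graph H as a pattern: there are positions
-- a_1 < … < a_k such that every edge u_i u_j of H maps to an edge
-- v_{a_i} v_{a_j} of G - E(P).  Since P is injective, v_{a_i} v_{a_j} is
-- an edge of P exactly when a_i and a_j are consecutive positions.
ContainsPattern : ∀ {n k} → Graph n → (Fin n → Fin n) → Graph k → Set
ContainsPattern {n} {k} G P H =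
  Σ (Fin k → Fin n) λ a →
    (∀ (i j : Fin k) → i < j → a i < a j) ×
    (∀ (i j : Fin k) → adj H i j ≡ true →
       (adj G (P (a i)) (P (a j)) ≡ true) × (¬C (a i) (a j)))
  where
  ¬C : Fin n → Fin n → Set
  ¬C x y = Consecutive x y → ⊥

Avoids : ∀ {n k} → Graph n → (Fin n → Fin n) → Graph k → Set
Avoids G P H = ContainsPattern G P H → ⊥

HasInducedPathOn : ∀ {n} → Graph n → ℕ → Set
HasInducedPathOn {n} G m =
  Σ (Fin m → Fin n) λ f →
    Injective _≡_ _≡_ f ×
    (∀ (i j : Fin m) → (adj G (f i) (f j) ≡ true → Consecutive i j) ×
                        (Consecutive i j → adj G (f i) (f j) ≡ true))

HasInducedPathAtLeast : ∀ {n} → Graph n → ℕ → Set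
HasInducedPathAtLeast G t = ∃[ m ] (t ≤ m × HasInducedPathOn G m)

-- "g_H(n) ≥ t": every graph G with Hamiltonian path P on n vertices such that
-- (G , P) avoids H has an induced path on at least t vertices.
-- (g_H(n) is the largest such t; the property is downward closed in t.)
gAtLeast : ∀ {k} → Graph k → ℕ → ℕ → Set
gAtLeast H n t =
  ∀ (G : Graph n) (P : Fin n → Fin n) → IsHamPath G P → Avoids G P H →
    HasInducedPathAtLeast G t

GrowsFasterThanLog : ∀ {k} → Graph k → Set
GrowsFasterThanLog H =
  ∀ (C : ℕ) → ∃[ N ] (∀ n → N ≤ n → gAtLeast H n (C * ⌊log₂ n ⌋))

MaxDegreeAtMostOne : ∀ {k} → Graph k → Set
MaxDegreeAtMostOne {k} H =
  ∀ (u v w : Fin k) → adj H u v ≡ true → adj H u w ≡ true → v ≡ w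

-- If a vertex u of H has two neighbours v ≠ w, we exhibit graphs G with Hamiltonian path P
-- on arbitrarily many vertices n such that (G, P) avoids H but every induced path of G has
-- O(log n) vertices, contradicting g_H(n) = ω(log n).
--
-- If v and w both come after u, G is the doubling graph of level k: a start vertex, two
-- copies of level k − 1 and an end vertex, with P running through them in this order and
-- the extra edges start–end and (last of the left copy)–end.  Every vertex has at most one
-- neighbour two or more positions later along P, so no vertex can play the role of u.
-- An induced path starting at the first or last vertex has at most 3k + 1 vertices, since
-- after three vertices it is trapped in a copy; any induced path splits into two of those,
-- while G has at least 2^k vertices.
--
-- If v and w both come before u, apply this to H with the order reversed.  If they lie on
-- either side of u, G is the half graph joining an even e to an odd o when e ≤ o + 1, with
-- P = 0, 1, …, n − 1: long edges go forward from even and backward from odd vertices, so u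
-- again has no image, and the half graph has no induced 2K₂, hence no induced P₅.

module Submission where

open import Defs
open import Data.Bool using (Bool; true; false; _∧_; _∨_; not; if_then_else_)
open import Data.Bool.Properties using (∧-comm; ∨-comm; ¬-not; not-¬; T-≡)
open import Data.Empty using (⊥-elim)
open import Data.Fin using (Fin; toℕ; zero; suc; opposite; splitAt) renaming (_<_ to _<ᶠ_)
open import Data.Fin.Properties
  using (toℕ-↑ˡ; toℕ-↑ʳ; splitAt⁻¹-↑ˡ; splitAt⁻¹-↑ʳ; toℕ-injective; opposite-prop; opposite-involutive; toℕ<n)
import Data.Fin.Properties as Fin
open import Data.List using (List; []; _∷_; _++_; _∷ʳ_; [_]; length; map; reverse; tabulate)
open import Data.List.Properties
  using (length-++; length-map; length-reverse; length-tabulate; unfold-reverse; reverse-++; ++-assoc)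
open import Data.List.Relation.Unary.All as All using (All; []; _∷_)
open import Data.List.Relation.Unary.All.Properties using (++⁺; ++⁻ˡ; ++⁻ʳ; map⁻; tabulate⁺)
open import Data.List.Relation.Binary.Permutation.Propositional using (↭-sym)
open import Data.List.Relation.Binary.Permutation.Propositional.Properties using (All-resp-↭; ↭-reverse)
open import Data.Nat using (ℕ; zero; suc; _+_; _*_; _^_; _≤_; _<_; _≤ᵇ_; z≤n; s≤s)
open import Data.Nat.Logarithm using (⌊log₂_⌋; ⌊log₂⌋-mono-≤; ⌊log₂[2^n]⌋≡n)
open import Data.Nat.Properties
  using (≤-refl; ≤-reflexive; ≤-trans; ≤-total; <⇒≤; <⇒≢; <⇒≱; ≰⇒>; ≤∧≢⇒<; <-irrefl; 1+n≰n; n≤1+n;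
         suc-injective; +-comm; +-suc; +-identityʳ; +-cancelˡ-≡; +-cancelʳ-≡; +-cancelˡ-≤;
         +-mono-≤; +-monoˡ-≤; +-monoʳ-<; m≤m+n; m≤n+m; m<m+n; m+1+n≰m; m+n≡0⇒m≡0; m∸n+n≡m;
         *-suc; *-monoʳ-≤; ≤ᵇ⇒≤; ≤⇒≤ᵇ; module ≤-Reasoning)
open import Data.Product using (Σ; ∃-syntax; _×_; _,_; proj₁; proj₂)
open import Data.Sum using (_⊎_; inj₁; inj₂)
import Data.Sum as Sum
open import Data.Unit using (⊤; tt)
open import Function using (id; _∘_; case_of_)
open import Function.Bundles using (Equivalence)
open import Function.Definitions using (Injective)
open import Relation.Binary.Definitions using (tri<; tri≈; tri>)
open import Relation.Binary.PropositionalEquality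
  using (_≡_; _≢_; refl; trans; cong; subst; subst₂; ≢-sym; module ≡-Reasoning) renaming (sym to ≡-sym)
open import Relation.Nullary using (¬_; yes; no)

length-through : ∀ {X : Set} ys (x : X) zs → length (ys ++ x ∷ zs) ≤ length (x ∷ reverse ys) + length (x ∷ zs)
length-through ys x zs = begin
  length (ys ++ x ∷ zs)                     ≡⟨ length-++ ys ⟩
  length ys + length (x ∷ zs)               ≤⟨ +-monoˡ-≤ (length (x ∷ zs)) (n≤1+n (length ys)) ⟩
  suc (length ys) + length (x ∷ zs)         ≡⟨ cong (λ n → suc n + length (x ∷ zs)) (≡-sym (length-reverse ys)) ⟩
  length (x ∷ reverse ys) + length (x ∷ zs) ∎
  where open ≤-Reasoning

module InducedPaths {X : Set} (adj : X → X → Bool) (adj-sym : ∀ x y → adj x y ≡ adj y x) where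

  Far : X → X → Set
  Far x z = adj x z ≡ false × x ≢ z

  far-sym : ∀ {x z} → Far x z → Far z x
  far-sym {x} {z} (nonadj , x≢z) = trans (adj-sym z x) nonadj , ≢-sym x≢z

  far⇒≢ : ∀ {x z} → Far x z → z ≢ x
  far⇒≢ (_ , x≢z) = ≢-sym x≢z

  far⇒≢-neighbour : ∀ {x z t} → Far x z → adj x t ≡ true → z ≢ t
  far⇒≢-neighbour (nonadj , _) x~t refl = not-¬ nonadj x~t

  Leads : X → List X → Set
  Leads x []       = ⊤
  Leads x (y ∷ zs) = adj x y ≡ true × All (Far x) zs

  IsInducedPath : List X → Set
  IsInducedPath []       = ⊤
  IsInducedPath (x ∷ xs) = Leads x xs × IsInducedPath xs

  isInducedPath-++⁻ʳ : ∀ ys {zs} → IsInducedPath (ys ++ zs) → IsInducedPath zs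
  isInducedPath-++⁻ʳ []       p       = p
  isInducedPath-++⁻ʳ (y ∷ ys) (_ , p) = isInducedPath-++⁻ʳ ys p

  leads-++⁻ˡ : ∀ {x} ys {zs} → Leads x (ys ++ zs) → Leads x ys
  leads-++⁻ˡ []       _             = tt
  leads-++⁻ˡ (y ∷ ys) (x~y , fars) = x~y , ++⁻ˡ ys fars

  isInducedPath-++⁻ˡ : ∀ ys {zs} → IsInducedPath (ys ++ zs) → IsInducedPath ys
  isInducedPath-++⁻ˡ []       _         = tt
  isInducedPath-++⁻ˡ (y ∷ ys) (l , p) = leads-++⁻ˡ ys l , isInducedPath-++⁻ˡ ys p

  Trails : List X → X → Set
  Trails []            x = ⊤
  Trails (y ∷ [])      x = adj y x ≡ true
  Trails (y ∷ y′ ∷ ys) x = Far y x × Trails (y′ ∷ ys) x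

  trails-∷ʳ : ∀ {x y} zs → All (λ z → Far z x) zs → adj y x ≡ true → Trails (zs ∷ʳ y) x
  trails-∷ʳ []            _            y~x = y~x
  trails-∷ʳ (z ∷ [])      (f ∷ _)      y~x = f , y~x
  trails-∷ʳ (z ∷ z′ ∷ zs) (f ∷ fs)     y~x = f , trails-∷ʳ (z′ ∷ zs) fs y~x

  isInducedPath-∷ʳ : ∀ {x} ys → IsInducedPath ys → Trails ys x → IsInducedPath (ys ∷ʳ x)
  isInducedPath-∷ʳ []            _                  _         = tt , tt
  isInducedPath-∷ʳ (y ∷ [])      _                  y~x       = (y~x , []) , tt , tt
  isInducedPath-∷ʳ (y ∷ y′ ∷ ys) ((y~y′ , fs) , p) (f , t) =
    (y~y′ , ++⁺ fs (f ∷ [])) , isInducedPath-∷ʳ (y′ ∷ ys) p t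

  leads⇒trails-reverse : ∀ {x} xs → Leads x xs → Trails (reverse xs) x
  leads⇒trails-reverse []       _          = tt
  leads⇒trails-reverse {x} (y ∷ zs) (x~y , fs) =
    subst (λ ys → Trails ys x) (≡-sym (unfold-reverse y zs))
      (trails-∷ʳ (reverse zs) (All-resp-↭ (↭-sym (↭-reverse zs)) (All.map far-sym fs))
        (trans (adj-sym y x) x~y))

  isInducedPath-reverse : ∀ xs → IsInducedPath xs → IsInducedPath (reverse xs)
  isInducedPath-reverse []       _       = tt
  isInducedPath-reverse (x ∷ xs) (l , p) =
    subst IsInducedPath (≡-sym (unfold-reverse x xs))
      (isInducedPath-∷ʳ (reverse xs) (isInducedPath-reverse xs p) (leads⇒trails-reverse xs l))

  isInducedPath-split : ∀ ys {x} zs → IsInducedPath (ys ++ x ∷ zs) →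
                        IsInducedPath (x ∷ zs) × IsInducedPath (x ∷ reverse ys)
  isInducedPath-split ys {x} zs p =
    isInducedPath-++⁻ʳ ys p ,
    subst IsInducedPath (reverse-++ ys [ x ])
      (isInducedPath-reverse (ys ∷ʳ x)
        (isInducedPath-++⁻ˡ (ys ∷ʳ x) (subst IsInducedPath (≡-sym (++-assoc ys [ x ] zs)) p)))

  isInducedPath-stays : (P Q : X → Set) → (∀ {x y} → P x → adj x y ≡ true → Q y → P y) →
                        ∀ {x} xs → IsInducedPath (x ∷ xs) → P x → All Q xs → All P (x ∷ xs)
  isInducedPath-stays P Q closed []       _                  px []         = px ∷ []
  isInducedPath-stays P Q closed (y ∷ ys) ((x~y , _) , p) px (qy ∷ qys) =
    px ∷ isInducedPath-stays P Q closed ys p (closed px x~y qy) qys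

  tabulate-isInducedPath :
    ∀ {m} (g : Fin m → X) → Injective _≡_ _≡_ g →
    (∀ i j → (adj (g i) (g j) ≡ true → Consecutive i j) × (Consecutive i j → adj (g i) (g j) ≡ true)) →
    IsInducedPath (tabulate g)
  tabulate-isInducedPath {zero}        g g-inj g-path = tt
  tabulate-isInducedPath {suc zero}    g g-inj g-path = tt , tt
  tabulate-isInducedPath {suc (suc m)} g g-inj g-path =
    (proj₂ (g-path zero (suc zero)) (inj₁ refl) , tabulate⁺ far-from-head) ,
    tabulate-isInducedPath (g ∘ suc) (Fin.suc-injective ∘ g-inj) shifted
    where
    far-from-head : ∀ i → Far (g zero) (g (suc (suc i)))
    far-from-head i =
      ¬-not (λ adjacent → case proj₁ (g-path zero (suc (suc i))) adjacent of λ { (inj₁ ()) ; (inj₂ ()) }) ,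
      (λ eq → case g-inj eq of λ ())
    shifted : ∀ i j → (adj (g (suc i)) (g (suc j)) ≡ true → Consecutive i j) ×
                      (Consecutive i j → adj (g (suc i)) (g (suc j)) ≡ true)
    shifted i j = (λ e → Sum.map suc-injective suc-injective (proj₁ (g-path (suc i) (suc j)) e)) ,
                  (λ c → proj₂ (g-path (suc i) (suc j)) (Sum.map (cong suc) (cong suc) c))

  isInducedPath-through : (Q : X → Set) (B : ℕ) → ∀ ys {x} zs →
    IsInducedPath (ys ++ x ∷ zs) → All Q (ys ++ x ∷ zs) →
    (∀ ws → IsInducedPath (x ∷ ws) → All Q ws → length (x ∷ ws) ≤ B) →
    length (ys ++ x ∷ zs) ≤ B + B
  isInducedPath-through Q B ys {x} zs p qs rooted with isInducedPath-split ys zs p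
  ... | forward , backward = ≤-trans (length-through ys x zs)
    (+-mono-≤ (rooted (reverse ys) backward (All-resp-↭ (↭-sym (↭-reverse ys)) (++⁻ˡ ys qs)))
              (rooted zs forward (All.tail (++⁻ʳ ys qs))))

split-at-match : ∀ {X : Set} (p : X → Bool) L →
  (∃[ ys ] ∃[ x ] ∃[ zs ] L ≡ ys ++ x ∷ zs × p x ≡ true) ⊎ All (λ z → p z ≡ false) L
split-at-match p []       = inj₂ []
split-at-match p (x ∷ L) with p x in px
... | true  = inj₁ ([] , x , L , refl , px)
... | false with split-at-match p L
...   | inj₁ (ys , y , zs , refl , py) = inj₁ (x ∷ ys , y , zs , refl , py)
...   | inj₂ none                      = inj₂ (px ∷ none)

separated-by : ∀ {X : Set} (p : X → Bool) {z t : X} → p z ≡ false → p t ≡ true → z ≢ t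
separated-by p pz pt refl = not-¬ pz pt

-- The doubling graph

data Vertex : ℕ → Set where
  base       : Vertex zero
  start end  : ∀ {k} → Vertex (suc k)
  left right : ∀ {k} → Vertex k → Vertex (suc k)

first last : ∀ k → Vertex k
first zero    = base
first (suc k) = start
last zero     = base
last (suc k)  = end

isFirst isLast : ∀ {k} → Vertex k → Bool
isFirst base  = true
isFirst start = true
isFirst _     = false
isLast base   = true
isLast end    = true
isLast _      = false

isFirst-first : ∀ k → isFirst (first k) ≡ true
isFirst-first zero    = refl
isFirst-first (suc k) = refl

isLast-last : ∀ k → isLast (last k) ≡ true
isLast-last zero    = refl
isLast-last (suc k) = refl

isFirst⇒≡first : ∀ {k} {x : Vertex k} → isFirst x ≡ true → x ≡ first k
isFirst⇒≡first {x = base}  _ = refl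
isFirst⇒≡first {x = start} _ = refl

isLast⇒≡last : ∀ {k} {x : Vertex k} → isLast x ≡ true → x ≡ last k
isLast⇒≡last {x = base} _ = refl
isLast⇒≡last {x = end}  _ = refl

edge : ∀ {k} → Vertex k → Vertex k → Bool
edge base      base      = false
edge start     start     = false
edge start     (left y)  = isFirst y
edge start     (right y) = false
edge start     end       = true
edge (left x)  start     = isFirst x
edge (left x)  (left y)  = edge x y
edge (left x)  (right y) = isLast x ∧ isFirst y
edge (left x)  end       = isLast x
edge (right x) start     = false
edge (right x) (left y)  = isFirst x ∧ isLast y
edge (right x) (right y) = edge x y
edge (right x) end       = isLast x
edge end       start     = true
edge end       (left y)  = isLast y
edge end       (right y) = isLast y
edge end       end       = false

edge-sym : ∀ {k} (x y : Vertex k) → edge x y ≡ edge y x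
edge-sym base      base      = refl
edge-sym start     start     = refl
edge-sym start     (left y)  = refl
edge-sym start     (right y) = refl
edge-sym start     end       = refl
edge-sym (left x)  start     = refl
edge-sym (left x)  (left y)  = edge-sym x y
edge-sym (left x)  (right y) = ∧-comm (isLast x) (isFirst y)
edge-sym (left x)  end       = refl
edge-sym (right x) start     = refl
edge-sym (right x) (left y)  = ∧-comm (isFirst x) (isLast y)
edge-sym (right x) (right y) = edge-sym x y
edge-sym (right x) end       = refl
edge-sym end       start     = refl
edge-sym end       (left y)  = refl
edge-sym end       (right y) = refl
edge-sym end       end       = refl

edge-irrefl : ∀ {k} (x : Vertex k) → edge x x ≡ false
edge-irrefl base      = refl
edge-irrefl start     = refl
edge-irrefl (left x)  = edge-irrefl x
edge-irrefl (right x) = edge-irrefl x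
edge-irrefl end       = refl

∧≡true⁻ : ∀ {a b} → a ∧ b ≡ true → (a ≡ true) × (b ≡ true)
∧≡true⁻ {true} {true} _ = refl , refl

∧≡true⁺ : ∀ {a b} → a ≡ true → b ≡ true → a ∧ b ≡ true
∧≡true⁺ refl refl = refl

edge-left-last-right-first : ∀ k → edge {suc k} (left (last k)) (right (first k)) ≡ true
edge-left-last-right-first k rewrite isLast-last k | isFirst-first k = refl

edge-first⇒first≢last : ∀ k {y : Vertex k} → edge (first k) y ≡ true → first k ≢ last k
edge-first⇒first≢last zero    {base} ()
edge-first⇒first≢last (suc k) _ ()

first≢last⇒edge : ∀ k → first k ≢ last k → edge (first k) (last k) ≡ true
first≢last⇒edge zero    first≢last = ⊥-elim (first≢last refl)
first≢last⇒edge (suc k) _          = refl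

-- Induced paths in the doubling graph

open module Paths {k} = InducedPaths (edge {k}) (edge-sym {k})

rootedBound : ℕ → ℕ
rootedBound zero    = 1
rootedBound (suc k) = 3 + rootedBound k

Terminal : ∀ {k} → Vertex k → Set
Terminal {k} x = x ≡ first k ⊎ x ≡ last k

RootedBound : ℕ → Set
RootedBound k = ∀ {x : Vertex k} → Terminal x → ∀ xs → IsInducedPath (x ∷ xs) →
                length (x ∷ xs) ≤ rootedBound k

InCopy : ∀ {k} → (Vertex k → Vertex (suc k)) → Vertex (suc k) → Set
InCopy c z = ∃[ y ] z ≡ c y

all-inCopy⇒map : ∀ {k} {c : Vertex k → Vertex (suc k)} L → All (InCopy c) L → ∃[ L′ ] L ≡ map c L′
all-inCopy⇒map []      []                = [] , refl
all-inCopy⇒map (_ ∷ L) ((y , refl) ∷ ps) with all-inCopy⇒map L ps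
... | L′ , refl = y ∷ L′ , refl

module Copy {k} (c : Vertex k → Vertex (suc k)) (c-edge : ∀ x y → edge (c x) (c y) ≡ edge x y) where

  far⁻ : ∀ {x z} → Far (c x) (c z) → Far x z
  far⁻ {x} {z} (nonadj , cx≢cz) = trans (≡-sym (c-edge x z)) nonadj , λ x≡z → cx≢cz (cong c x≡z)

  isInducedPath-map⁻ : ∀ L → IsInducedPath (map c L) → IsInducedPath L
  isInducedPath-map⁻ []           _                  = tt
  isInducedPath-map⁻ (x ∷ [])     _                  = tt , tt
  isInducedPath-map⁻ (x ∷ y ∷ zs) ((x~y , fars) , p) =
    (trans (≡-sym (c-edge x y)) x~y , All.map far⁻ (map⁻ fars)) , isInducedPath-map⁻ (y ∷ zs) p

  inCopy-length : ∀ {B} → (∀ L → IsInducedPath L → length L ≤ B) →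
                  ∀ L → IsInducedPath L → All (InCopy c) L → length L ≤ B
  inCopy-length {B} bound L p inside with all-inCopy⇒map L inside
  ... | L′ , refl = subst (_≤ B) (≡-sym (length-map c L′)) (bound L′ (isInducedPath-map⁻ L′ p))

  rooted-inCopy : RootedBound k → ∀ {x} → Terminal x → ∀ xs → IsInducedPath (c x ∷ xs) →
                  All (InCopy c) xs → length (c x ∷ xs) ≤ rootedBound k
  rooted-inCopy rooted {x} terminal xs p inside with all-inCopy⇒map xs inside
  ... | L′ , refl = subst (_≤ rootedBound k) (cong suc (≡-sym (length-map c L′)))
                      (rooted terminal L′ (isInducedPath-map⁻ (x ∷ L′) p))

module LeftCopy  {k} = Copy {k} left  (λ _ _ → refl)
module RightCopy {k} = Copy {k} right (λ _ _ → refl)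

-- The neighbours of the left copy outside it are start, end and the first
-- vertex of the right copy; those of the right copy are end and the last
-- vertex of the left copy.
ClearOfLeft ClearOfRight : ∀ {k} → Vertex (suc k) → Set
ClearOfLeft  {k} z = z ≢ start × z ≢ end × z ≢ right (first k)
ClearOfRight {k} z = z ≢ start × z ≢ end × z ≢ left (last k)

InLeftBelowLast : ∀ {k} → Vertex (suc k) → Set
InLeftBelowLast {k} z = ∃[ y ] z ≡ left y × y ≢ last k

inLeft-step : ∀ {k} {x y : Vertex (suc k)} → InCopy left x → edge x y ≡ true → ClearOfLeft y → InCopy left y
inLeft-step {y = start}   _ _ (≢start , _) = ⊥-elim (≢start refl)
inLeft-step {y = end}     _ _ (_ , ≢end , _) = ⊥-elim (≢end refl)
inLeft-step {y = left y}  _ _ _ = y , refl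
inLeft-step {y = right y} (x , refl) x~y (_ , _ , ≢first) =
  ⊥-elim (≢first (cong right (isFirst⇒≡first (proj₂ (∧≡true⁻ {isLast x} x~y)))))

inLeftBelowLast-step : ∀ {k} {x y : Vertex (suc k)} →
                       InLeftBelowLast x → edge x y ≡ true → ClearOfRight y → InLeftBelowLast y
inLeftBelowLast-step {y = start}   _ _ (≢start , _) = ⊥-elim (≢start refl)
inLeftBelowLast-step {y = end}     _ _ (_ , ≢end , _) = ⊥-elim (≢end refl)
inLeftBelowLast-step {y = left y}  _ _ (_ , _ , ≢last) = y , refl , λ y≡last → ≢last (cong left y≡last)
inLeftBelowLast-step {y = right y} (x , refl , x≢last) x~y _ =
  ⊥-elim (x≢last (isLast⇒≡last (proj₁ (∧≡true⁻ {isLast x} x~y))))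

inRight-step : ∀ {k} {x y : Vertex (suc k)} → InCopy right x → edge x y ≡ true → ClearOfRight y → InCopy right y
inRight-step {x = .(right x)} {start}   (x , refl) () _
inRight-step {y = end}     _ _ (_ , ≢end , _) = ⊥-elim (≢end refl)
inRight-step {y = right y} _ _ _ = y , refl
inRight-step {y = left y}  (x , refl) x~y (_ , _ , ≢last) =
  ⊥-elim (≢last (cong left (isLast⇒≡last (proj₂ (∧≡true⁻ {isFirst x} x~y)))))

1+m≤3+n : ∀ {m n} → m ≤ n → 1 + m ≤ 3 + n
1+m≤3+n m≤n = s≤s (≤-trans m≤n (≤-trans (n≤1+n _) (n≤1+n _)))

2+m≤3+n : ∀ {m n} → m ≤ n → 2 + m ≤ 3 + n
2+m≤3+n m≤n = s≤s (s≤s (≤-trans m≤n (n≤1+n _)))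

3+m≤3+n : ∀ {m n} → m ≤ n → 3 + m ≤ 3 + n
3+m≤3+n m≤n = s≤s (s≤s (s≤s m≤n))

-- A rooted induced path of level k+1 enters a copy through one of the copy's terminal vertices
-- after at most three vertices, and is then confined to that copy, because the earlier vertices
-- are adjacent to all its ways out.  Entering the left copy at its first vertex, it cannot reach
-- the last one, which is adjacent to the first when k ≥ 1.
module RootedStep {k} (rooted : RootedBound k) where

  left-tail : ∀ {x} → Terminal x → ∀ xs → IsInducedPath (left x ∷ xs) → All ClearOfLeft xs →
              length (left x ∷ xs) ≤ rootedBound k
  left-tail terminal xs p clear =
    LeftCopy.rooted-inCopy rooted terminal xs p
      (All.tail (isInducedPath-stays (InCopy left) ClearOfLeft inLeft-step xs p (_ , refl) clear))

  left-first-tail : first k ≢ last k → ∀ xs → IsInducedPath (left (first k) ∷ xs) → All ClearOfRight xs →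
                    length (left (first k) ∷ xs) ≤ rootedBound k
  left-first-tail first≢last xs p clear =
    LeftCopy.rooted-inCopy rooted (inj₁ refl) xs p
      (All.map (λ { (y , eq , _) → y , eq })
        (All.tail (isInducedPath-stays InLeftBelowLast ClearOfRight inLeftBelowLast-step xs p
                    (_ , refl , first≢last) clear)))

  right-tail : ∀ {x} → Terminal x → ∀ xs → IsInducedPath (right x ∷ xs) → All ClearOfRight xs →
               length (right x ∷ xs) ≤ rootedBound k
  right-tail terminal xs p clear =
    RightCopy.rooted-inCopy rooted terminal xs p
      (All.tail (isInducedPath-stays (InCopy right) ClearOfRight inRight-step xs p (_ , refl) clear))

  from-start-end-leftLast : ∀ rest → All (Far start) rest → All (Far end) rest →
                            IsInducedPath (left (last k) ∷ rest) →
                            length (start ∷ end ∷ left (last k) ∷ rest) ≤ rootedBound (suc k)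
  from-start-end-leftLast []              _                _               _ = s≤s (s≤s (s≤s z≤n))
  from-start-end-leftLast (start ∷ _)     ((_ , ≢s) ∷ _)   _               _ = ⊥-elim (≢s refl)
  from-start-end-leftLast (end ∷ _)       _                ((_ , ≢e) ∷ _)  _ = ⊥-elim (≢e refl)
  from-start-end-leftLast (right y ∷ rest) (_ ∷ far-s) (_ ∷ far-e) ((l~y , far-l) , p)
    with isFirst⇒≡first (proj₂ (∧≡true⁻ {isLast (last k)} l~y))
  ... | refl = 3+m≤3+n (right-tail (inj₁ refl) rest p
                 (All.zipWith (λ ((fs , fe) , fl) → far⇒≢ fs , far⇒≢ fe , far⇒≢ fl)
                   (All.zip (far-s , far-e) , far-l)))
  from-start-end-leftLast (left y ∷ rest) (_ ∷ far-s) (_ ∷ far-e) p@((_ , far-l) , _) =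
    2+m≤3+n (left-tail (inj₂ refl) (left y ∷ rest) p
      (((λ ()) , (λ ()) , (λ ())) ∷
       All.zipWith (λ ((fs , fe) , fl) → far⇒≢ fs , far⇒≢ fe , far⇒≢-neighbour fl (edge-left-last-right-first k))
         (All.zip (far-s , far-e) , far-l)))

  from-start-end : ∀ rest → All (Far start) rest → IsInducedPath {suc k} (end ∷ rest) →
                   length (start ∷ end ∷ rest) ≤ rootedBound (suc k)
  from-start-end []               _              _ = s≤s (s≤s z≤n)
  from-start-end (start ∷ _)      ((_ , ≢s) ∷ _) _ = ⊥-elim (≢s refl)
  from-start-end (end ∷ _)        _              ((() , _) , _)
  from-start-end (right y ∷ rest) (_ ∷ far-s) ((e~y , far-e) , p) with isLast⇒≡last e~y
  ... | refl = 2+m≤3+n (right-tail (inj₂ refl) rest p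
                 (All.zipWith (λ (fs , fe) → far⇒≢ fs , far⇒≢ fe , far⇒≢-neighbour fe (isLast-last k))
                   (far-s , far-e)))
  from-start-end (left y ∷ rest)  (_ ∷ far-s) ((e~y , far-e) , p) with isLast⇒≡last e~y
  ... | refl = from-start-end-leftLast rest far-s far-e p

  from-start-leftFirst-leftLast : ∀ rest → All (Far start) rest → IsInducedPath (left (last k) ∷ rest) →
                                  length (start ∷ left (first k) ∷ left (last k) ∷ rest) ≤ rootedBound (suc k)
  from-start-leftFirst-leftLast []               _              _ = s≤s (s≤s (s≤s z≤n))
  from-start-leftFirst-leftLast (start ∷ _)      ((_ , ≢s) ∷ _) _ = ⊥-elim (≢s refl)
  from-start-leftFirst-leftLast (end ∷ _)        ((() , _) ∷ _) _
  from-start-leftFirst-leftLast (right y ∷ rest) (_ ∷ far-s) ((l~y , far-l) , p)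
    with isFirst⇒≡first (proj₂ (∧≡true⁻ {isLast (last k)} l~y))
  ... | refl = 3+m≤3+n (right-tail (inj₁ refl) rest p
                 (All.zipWith (λ (fs , fl) → far⇒≢ fs , far⇒≢-neighbour fs refl , far⇒≢ fl) (far-s , far-l)))
  from-start-leftFirst-leftLast (left y ∷ rest) (_ ∷ far-s) p@((_ , far-l) , _) =
    2+m≤3+n (left-tail (inj₂ refl) (left y ∷ rest) p
      (((λ ()) , (λ ()) , (λ ())) ∷
       All.zipWith (λ (fs , fl) → far⇒≢ fs , far⇒≢-neighbour fs refl ,
                                  far⇒≢-neighbour fl (edge-left-last-right-first k))
         (far-s , far-l)))

  from-start-leftFirst : ∀ rest → All (Far start) rest → IsInducedPath (left (first k) ∷ rest) →
                         length (start ∷ left (first k) ∷ rest) ≤ rootedBound (suc k)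
  from-start-leftFirst []               _              _ = s≤s (s≤s z≤n)
  from-start-leftFirst (start ∷ _)      ((_ , ≢s) ∷ _) _ = ⊥-elim (≢s refl)
  from-start-leftFirst (end ∷ _)        ((() , _) ∷ _) _
  from-start-leftFirst (right y ∷ rest) (_ ∷ far-s) ((f~y , far-f) , p)
    with ∧≡true⁻ {isLast (first k)} f~y
  ... | first-is-last , y-is-first with isFirst⇒≡first y-is-first | isLast⇒≡last first-is-last
  ...   | refl | first≡last =
    2+m≤3+n (right-tail (inj₁ refl) rest p
      (All.zipWith (λ (fs , ff) → far⇒≢ fs , far⇒≢-neighbour fs refl ,
                                  λ eq → far⇒≢ ff (trans eq (cong left (≡-sym first≡last))))
        (far-s , far-f)))
  from-start-leftFirst (left y ∷ rest) (_ ∷ far-s) ((f~y , far-f) , p) with isLast y in y-last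
  ... | true with isLast⇒≡last y-last
  ...   | refl = from-start-leftFirst-leftLast rest far-s p
  from-start-leftFirst (left y ∷ rest) (_ ∷ far-s) p | false =
    1+m≤3+n (left-first-tail first≢last (left y ∷ rest) p
      (((λ ()) , (λ ()) , λ { refl → y≢last refl }) ∷
       All.zipWith (λ (fs , ff) → far⇒≢ fs , far⇒≢-neighbour fs refl ,
                                  far⇒≢-neighbour ff (first≢last⇒edge k first≢last))
         (far-s , proj₂ (proj₁ p))))
    where
    first≢last : first k ≢ last k
    first≢last = edge-first⇒first≢last k (proj₁ (proj₁ p))
    y≢last : y ≢ last k
    y≢last refl = not-¬ y-last (isLast-last k)

  from-start : ∀ xs → IsInducedPath {suc k} (start ∷ xs) → length (start ∷ xs) ≤ rootedBound (suc k)
  from-start []               _                      = s≤s z≤n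
  from-start (start ∷ _)      ((() , _) , _)
  from-start (right _ ∷ _)    ((() , _) , _)
  from-start (end ∷ rest)     ((_ , far-s) , p)      = from-start-end rest far-s p
  from-start (left y ∷ rest)  ((s~y , far-s) , p) with isFirst⇒≡first s~y
  ... | refl = from-start-leftFirst rest far-s p

  from-end-start : ∀ rest → All (Far end) rest → IsInducedPath {suc k} (start ∷ rest) →
                   length (end ∷ start ∷ rest) ≤ rootedBound (suc k)
  from-end-start []               _              _ = s≤s (s≤s z≤n)
  from-end-start (start ∷ _)      _              ((() , _) , _)
  from-end-start (right _ ∷ _)    _              ((() , _) , _)
  from-end-start (end ∷ _)        ((_ , ≢e) ∷ _) _ = ⊥-elim (≢e refl)
  from-end-start (left y ∷ rest)  (far-ey ∷ far-e) ((s~y , far-s) , p) with isFirst⇒≡first s~y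
  ... | refl = 2+m≤3+n (left-first-tail first≢last rest p
                 (All.zipWith (λ (fs , fe) → far⇒≢ fs , far⇒≢ fe , far⇒≢-neighbour fe (isLast-last k))
                   (far-s , far-e)))
    where
    first≢last : first k ≢ last k
    first≢last first≡last = not-¬ (proj₁ far-ey) (trans (cong isLast first≡last) (isLast-last k))

  from-end-leftLast : ∀ rest → All (Far end) rest → IsInducedPath (left (last k) ∷ rest) →
                      length (end ∷ left (last k) ∷ rest) ≤ rootedBound (suc k)
  from-end-leftLast []               _              _ = s≤s (s≤s z≤n)
  from-end-leftLast (start ∷ _)      ((() , _) ∷ _) _
  from-end-leftLast (end ∷ _)        ((_ , ≢e) ∷ _) _ = ⊥-elim (≢e refl)
  from-end-leftLast (right y ∷ rest) (_ ∷ far-e) ((l~y , far-l) , p)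
    with isFirst⇒≡first (proj₂ (∧≡true⁻ {isLast (last k)} l~y))
  ... | refl = 2+m≤3+n (right-tail (inj₁ refl) rest p
                 (All.zipWith (λ (fe , fl) → far⇒≢-neighbour fe refl , far⇒≢ fe , far⇒≢ fl) (far-e , far-l)))
  from-end-leftLast (left y ∷ rest)  (_ ∷ far-e) p@((_ , far-l) , _) =
    1+m≤3+n (left-tail (inj₂ refl) (left y ∷ rest) p
      (((λ ()) , (λ ()) , (λ ())) ∷
       All.zipWith (λ (fe , fl) → far⇒≢-neighbour fe refl , far⇒≢ fe ,
                                  far⇒≢-neighbour fl (edge-left-last-right-first k))
         (far-e , far-l)))

  from-end : ∀ xs → IsInducedPath {suc k} (end ∷ xs) → length (end ∷ xs) ≤ rootedBound (suc k)
  from-end []               _                    = s≤s z≤n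
  from-end (end ∷ _)        ((() , _) , _)
  from-end (start ∷ rest)   ((_ , far-e) , p)    = from-end-start rest far-e p
  from-end (right y ∷ rest) ((e~y , far-e) , p) with isLast⇒≡last e~y
  ... | refl = 1+m≤3+n (right-tail (inj₂ refl) rest p
                 (All.map (λ fe → far⇒≢-neighbour fe refl , far⇒≢ fe , far⇒≢-neighbour fe (isLast-last k)) far-e))
  from-end (left y ∷ rest)  ((e~y , far-e) , p) with isLast⇒≡last e~y
  ... | refl = from-end-leftLast rest far-e p

rootedBound-holds : ∀ k → RootedBound k
rootedBound-holds zero    {base} _ []           _              = s≤s z≤n
rootedBound-holds zero    {base} _ (base ∷ _)   ((() , _) , _)
rootedBound-holds (suc k) (inj₁ refl) = RootedStep.from-start (rootedBound-holds k)
rootedBound-holds (suc k) (inj₂ refl) = RootedStep.from-end (rootedBound-holds k)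

isTop isLeftLast : ∀ {k} → Vertex (suc k) → Bool
isTop start = true
isTop end   = true
isTop _     = false
isLeftLast (left x) = isLast x
isLeftLast _        = false

isLeftLast⇒≡ : ∀ {k} {x : Vertex (suc k)} → isLeftLast x ≡ true → x ≡ left (last k)
isLeftLast⇒≡ {x = left x} x-last = cong left (isLast⇒≡last x-last)

clearOfRight : ∀ {k} {z : Vertex (suc k)} → isTop z ≡ false → isLeftLast z ≡ false → ClearOfRight z
clearOfRight {k} not-top not-leftLast =
  separated-by isTop not-top refl , separated-by isTop not-top refl ,
  separated-by isLeftLast not-leftLast (isLast-last k)

from-top : ∀ {k} {x : Vertex (suc k)} → isTop x ≡ true → ∀ ws → IsInducedPath (x ∷ ws) →
           length (x ∷ ws) ≤ rootedBound (suc k)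
from-top {k} {start} _ = rootedBound-holds (suc k) (inj₁ refl)
from-top {k} {end}   _ = rootedBound-holds (suc k) (inj₂ refl)

from-leftLast : ∀ {k} ws → IsInducedPath (left (last k) ∷ ws) → All (λ z → isTop z ≡ false) ws →
                length (left (last k) ∷ ws) ≤ rootedBound (suc k)
from-leftLast []             _ _ = s≤s z≤n
from-leftLast {k} (right y ∷ ws) ((l~y , far-l) , p) (_ ∷ not-top)
  with isFirst⇒≡first (proj₂ (∧≡true⁻ {isLast (last k)} l~y))
... | refl = 1+m≤3+n (RootedStep.right-tail (rootedBound-holds k) (inj₁ refl) ws p
               (All.zipWith (λ (nt , fl) → separated-by isTop nt refl , separated-by isTop nt refl , far⇒≢ fl)
                 (not-top , far-l)))
from-leftLast {k} (left y ∷ ws) p@((_ , far-l) , _) (_ ∷ not-top) =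
  ≤-trans (RootedStep.left-tail (rootedBound-holds k) (inj₂ refl) (left y ∷ ws) p
            (((λ ()) , (λ ()) , (λ ())) ∷
             All.zipWith (λ (nt , fl) → separated-by isTop nt refl , separated-by isTop nt refl ,
                                         far⇒≢-neighbour fl (edge-left-last-right-first k))
               (not-top , far-l)))
          (m≤n+m _ 3)

inducedPath-length : ∀ k (L : List (Vertex k)) → IsInducedPath L → length L ≤ rootedBound k + rootedBound k
inducedPath-length zero    []              _              = z≤n
inducedPath-length zero    (base ∷ [])     _              = s≤s z≤n
inducedPath-length zero    (base ∷ base ∷ _) ((() , _) , _)
inducedPath-length (suc k) L p with split-at-match isTop L
... | inj₁ (ys , x , zs , refl , top) =
  isInducedPath-through (λ _ → ⊤) _ ys zs p (All.universal (λ _ → tt) _) (λ ws q _ → from-top top ws q)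
... | inj₂ not-top with split-at-match isLeftLast L
...   | inj₁ (ys , x , zs , refl , leftLast) with isLeftLast⇒≡ {x = x} leftLast
...     | refl = isInducedPath-through _ _ ys zs p not-top from-leftLast
inducedPath-length (suc k) L p | inj₂ not-top | inj₂ not-leftLast =
  ≤-trans (within-copy L p (All.zipWith (λ (nt , nl) → clearOfRight nt nl) (not-top , not-leftLast)))
          (+-mono-≤ (m≤n+m _ 3) (m≤n+m _ 3))
  where
  -- Avoiding start, end and the last vertex of the left copy, the path cannot leave the copy it starts in.
  within-copy : ∀ L → IsInducedPath L → All ClearOfRight L → length L ≤ rootedBound k + rootedBound k
  within-copy []             _ _ = z≤n
  within-copy (start ∷ _)    _ ((≢s , _) ∷ _) = ⊥-elim (≢s refl)
  within-copy (end ∷ _)      _ ((_ , ≢e , _) ∷ _) = ⊥-elim (≢e refl)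
  within-copy (left y ∷ xs)  p ((_ , _ , ≢l) ∷ clear) =
    LeftCopy.inCopy-length (inducedPath-length k) (left y ∷ xs) p
      (All.map (λ { (y , eq , _) → y , eq })
        (isInducedPath-stays InLeftBelowLast ClearOfRight inLeftBelowLast-step xs p
          (y , refl , λ { refl → ≢l refl }) clear))
  within-copy (right y ∷ xs) p (_ ∷ clear) =
    RightCopy.inCopy-length (inducedPath-length k) (right y ∷ xs) p
      (isInducedPath-stays (InCopy right) ClearOfRight inRight-step xs p (y , refl) clear)

-- Positions along the Hamiltonian path of the doubling graph

size : ℕ → ℕ
size zero    = 1
size (suc k) = suc (size k + (size k + 1))

position : ∀ {k} → Vertex k → ℕ
position base              = 0
position start             = 0
position {suc k} (left x)  = suc (position x)
position {suc k} (right x) = suc (size k + position x)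
position {suc k} end       = suc (size k + size k)

vertexAt : ∀ k → Fin (size k) → Vertex k
vertexAt zero    _       = base
vertexAt (suc k) zero    = start
vertexAt (suc k) (suc i) with splitAt (size k) i
... | inj₁ a = left (vertexAt k a)
... | inj₂ j with splitAt (size k) j
...   | inj₁ b = right (vertexAt k b)
...   | inj₂ _ = end

toℕ-splitAt-inj₁ : ∀ m {n} {i : Fin (m + n)} {a} → splitAt m i ≡ inj₁ a → toℕ i ≡ toℕ a
toℕ-splitAt-inj₁ m {n} {a = a} eq = trans (cong toℕ (≡-sym (splitAt⁻¹-↑ˡ eq))) (toℕ-↑ˡ a n)

toℕ-splitAt-inj₂ : ∀ m {n} {i : Fin (m + n)} {j} → splitAt m i ≡ inj₂ j → toℕ i ≡ m + toℕ j
toℕ-splitAt-inj₂ m {j = j} eq = trans (cong toℕ (≡-sym (splitAt⁻¹-↑ʳ eq))) (toℕ-↑ʳ m j)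

position-vertexAt : ∀ k (i : Fin (size k)) → position (vertexAt k i) ≡ toℕ i
position-vertexAt zero    zero    = refl
position-vertexAt (suc k) zero    = refl
position-vertexAt (suc k) (suc i) with splitAt (size k) i in eq
... | inj₁ a = cong suc (trans (position-vertexAt k a) (≡-sym (toℕ-splitAt-inj₁ (size k) eq)))
... | inj₂ j with splitAt (size k) j in eq′
...   | inj₁ b = cong suc (begin
          size k + position (vertexAt k b) ≡⟨ cong (size k +_) (position-vertexAt k b) ⟩
          size k + toℕ b                   ≡⟨ cong (size k +_) (toℕ-splitAt-inj₁ (size k) eq′) ⟨
          size k + toℕ j                   ≡⟨ toℕ-splitAt-inj₂ (size k) eq ⟨
          toℕ i                            ∎)
  where open ≡-Reasoning
...   | inj₂ zero = cong suc (begin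
          size k + size k     ≡⟨ cong (size k +_) (+-identityʳ (size k)) ⟨
          size k + (size k + 0) ≡⟨ cong (size k +_) (toℕ-splitAt-inj₂ (size k) eq′) ⟨
          size k + toℕ j      ≡⟨ toℕ-splitAt-inj₂ (size k) eq ⟨
          toℕ i               ∎)
  where open ≡-Reasoning

vertexAt-injective : ∀ k {i j : Fin (size k)} → vertexAt k i ≡ vertexAt k j → i ≡ j
vertexAt-injective k {i} {j} eq =
  toℕ-injective (trans (≡-sym (position-vertexAt k i)) (trans (cong position eq) (position-vertexAt k j)))

0<size : ∀ k → 0 < size k
0<size zero    = s≤s z≤n
0<size (suc k) = s≤s z≤n

size≢0 : ∀ k → size k ≢ 0
size≢0 k = <⇒≢ (0<size k) ∘ ≡-sym

size-suc : ∀ k → size (suc k) ≡ suc (suc (size k + size k))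
size-suc k = cong suc (trans (cong (size k +_) (+-comm (size k) 1)) (+-suc (size k) (size k)))

position<size : ∀ {k} (x : Vertex k) → position x < size k
position<size base              = s≤s z≤n
position<size start             = s≤s z≤n
position<size {suc k} (left x)  = s≤s (≤-trans (position<size x) (m≤m+n (size k) _))
position<size {suc k} (right x) = s≤s (+-monoʳ-< (size k) (≤-trans (position<size x) (m≤m+n (size k) 1)))
position<size {suc k} end       = subst (suc (size k + size k) <_) (≡-sym (size-suc k)) ≤-refl

position-first : ∀ k → position (first k) ≡ 0
position-first zero    = refl
position-first (suc k) = refl

suc-position-last : ∀ k → suc (position (last k)) ≡ size k
suc-position-last zero    = refl
suc-position-last (suc k) = ≡-sym (size-suc k)

position≡0⇒isFirst : ∀ {k} (y : Vertex k) → position y ≡ 0 → isFirst y ≡ true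
position≡0⇒isFirst base  _ = refl
position≡0⇒isFirst start _ = refl

suc-position≡size⇒isLast : ∀ {k} (x : Vertex k) → suc (position x) ≡ size k → isLast x ≡ true
suc-position≡size⇒isLast base _ = refl
suc-position≡size⇒isLast end  _ = refl
suc-position≡size⇒isLast {suc k} start eq = ⊥-elim (size≢0 k (m+n≡0⇒m≡0 (size k) (≡-sym (suc-injective eq))))
suc-position≡size⇒isLast {suc k} (left x) eq =
  ⊥-elim (<⇒≱ (m<m+n (size k) (≤-trans (0<size k) (m≤m+n (size k) 1)))
                (subst (_≤ size k) (suc-injective eq) (position<size x)))
suc-position≡size⇒isLast {suc k} (right x) eq =
  ⊥-elim (<⇒≢ (position<size x) (suc-injective (+-cancelˡ-≡ (size k) _ _ (begin
    size k + suc (position x) ≡⟨ +-suc (size k) (position x) ⟩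
    suc (size k + position x) ≡⟨ suc-injective eq ⟩
    size k + (size k + 1)     ≡⟨ cong (size k +_) (+-comm (size k) 1) ⟩
    size k + suc (size k)     ∎))))
  where open ≡-Reasoning

n+m≤n⇒m≡0 : ∀ n {m} → n + m ≤ n → m ≡ 0
n+m≤n⇒m≡0 n {zero}  _    = refl
n+m≤n⇒m≡0 n {suc m} le = ⊥-elim (m+1+n≰m n le)

edge-successor : ∀ {k} (x y : Vertex k) → position y ≡ suc (position x) → edge x y ≡ true
edge-successor base base ()
edge-successor start start ()
edge-successor (left x) start ()
edge-successor (right x) start ()
edge-successor start (left y) eq = position≡0⇒isFirst y (suc-injective eq)
edge-successor {suc k} start (right y) eq = ⊥-elim (size≢0 k (m+n≡0⇒m≡0 (size k) (suc-injective eq)))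
edge-successor {suc k} start end eq = ⊥-elim (size≢0 k (m+n≡0⇒m≡0 (size k) (suc-injective eq)))
edge-successor (left x) (left y) eq = edge-successor x y (suc-injective eq)
edge-successor {suc k} (left x) (right y) eq =
  ∧≡true⁺ (suc-position≡size⇒isLast x x-last) (position≡0⇒isFirst y y-first)
  where
  y-first : position y ≡ 0
  y-first = n+m≤n⇒m≡0 (size k) (subst (_≤ size k) (≡-sym (suc-injective eq)) (position<size x))
  x-last : suc (position x) ≡ size k
  x-last = trans (≡-sym (suc-injective eq)) (trans (cong (size k +_) y-first) (+-identityʳ (size k)))
edge-successor {suc k} (left x) end eq =
  ⊥-elim (size≢0 k (n+m≤n⇒m≡0 (size k) (subst (_≤ size k) (≡-sym (suc-injective eq)) (position<size x))))
edge-successor {suc k} (right x) (left y) eq =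
  ⊥-elim (<⇒≱ (position<size y)
    (≤-trans (m≤m+n (size k) (position x)) (≤-trans (n≤1+n _) (≤-reflexive (≡-sym (suc-injective eq))))))
edge-successor {suc k} (right x) (right y) eq =
  edge-successor x y (+-cancelˡ-≡ (size k) _ _ (trans (suc-injective eq) (≡-sym (+-suc (size k) (position x)))))
edge-successor {suc k} (right x) end eq =
  suc-position≡size⇒isLast x
    (≡-sym (+-cancelˡ-≡ (size k) _ _ (trans (suc-injective eq) (≡-sym (+-suc (size k) (position x))))))
edge-successor {suc k} end y eq =
  ⊥-elim (<⇒≢ (subst (position y <_) (size-suc k) (position<size y)) eq)

parent : ∀ {k} → Vertex k → Vertex k
parent base      = base
parent start     = end
parent end       = end
parent (left x)  = if isLast x then end else left (parent x)
parent (right x) = right (parent x)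

long-edge⇒parent : ∀ {k} (x y : Vertex k) → edge x y ≡ true → 2 + position x ≤ position y → y ≡ parent x
long-edge⇒parent base      base      () _
long-edge⇒parent start     start     () _
long-edge⇒parent start     (right y) () _
long-edge⇒parent start     end       _  _ = refl
long-edge⇒parent (left x)  start     _  ()
long-edge⇒parent (right x) start     _  ()
long-edge⇒parent {suc k} start (left y) s~y (s≤s gap) with isFirst⇒≡first s~y
... | refl = ⊥-elim (<⇒≱ (s≤s z≤n) (subst (1 ≤_) (position-first k) gap))
long-edge⇒parent {suc k} (left x) (left y) x~y (s≤s gap) with isLast x in x-last
... | false = cong left (long-edge⇒parent x y x~y gap)
... | true with isLast⇒≡last x-last
...   | refl = ⊥-elim (<⇒≱ (position<size y)
                 (≤-trans (≤-reflexive (≡-sym (suc-position-last k))) (≤-trans (n≤1+n _) gap)))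
long-edge⇒parent {suc k} (left x) (right y) x~y (s≤s gap) with ∧≡true⁻ {isLast x} x~y
... | x-last , y-first with isLast⇒≡last x-last | isFirst⇒≡first y-first
...   | refl | refl = ⊥-elim (1+n≰n (begin
  suc (size k)                         ≡⟨ cong suc (suc-position-last k) ⟨
  suc (suc (position (last k)))        ≤⟨ gap ⟩
  size k + position (first k)          ≡⟨ cong (size k +_) (position-first k) ⟩
  size k + 0                           ≡⟨ +-identityʳ (size k) ⟩
  size k                               ∎))
  where open ≤-Reasoning
long-edge⇒parent (left x) end x~y _ rewrite x~y = refl
long-edge⇒parent {suc k} (right x) (left y) _ (s≤s gap) =
  ⊥-elim (<⇒≱ (position<size y)
    (≤-trans (m≤m+n (size k) (position x)) (≤-trans (n≤1+n _) (≤-trans (n≤1+n _) gap))))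
long-edge⇒parent {suc k} (right x) (right y) x~y (s≤s gap) =
  cong right (long-edge⇒parent x y x~y
    (+-cancelˡ-≤ (size k) _ _ (subst (_≤ size k + position y) (+-suc-suc (size k) (position x)) gap)))
  where
  +-suc-suc : ∀ n m → suc (suc (n + m)) ≡ n + suc (suc m)
  +-suc-suc n m = ≡-sym (trans (+-suc n (suc m)) (cong suc (+-suc n m)))
long-edge⇒parent {suc k} (right x) end x~y (s≤s gap) with isLast⇒≡last x~y
... | refl = ⊥-elim (1+n≰n (begin
  suc (suc (size k + position (last k))) ≤⟨ gap ⟩
  size k + size k                        ≡⟨ cong (size k +_) (suc-position-last k) ⟨
  size k + suc (position (last k))       ≡⟨ +-suc (size k) (position (last k)) ⟩
  suc (size k + position (last k))       ∎))
  where open ≤-Reasoning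
long-edge⇒parent {suc k} end y _ gap =
  ⊥-elim (<⇒≱ (subst (position y <_) (size-suc k) (position<size y)) (≤-trans (n≤1+n _) gap))

-- The half graph

isEven : ℕ → Bool
isEven zero    = true
isEven (suc n) = not (isEven n)

reaches : ℕ → ℕ → Bool
reaches e o = isEven e ∧ not (isEven o) ∧ (e ≤ᵇ suc o)

reaches⁻ : ∀ e o → reaches e o ≡ true → (isEven e ≡ true) × (isEven o ≡ false) × (e ≤ suc o)
reaches⁻ e o r with isEven e | isEven o
... | true | false = refl , refl , ≤ᵇ⇒≤ e (suc o) (Equivalence.from T-≡ r)

reaches⁺ : ∀ {e o} → isEven e ≡ true → isEven o ≡ false → e ≤ suc o → reaches e o ≡ true
reaches⁺ {e} {o} e-even o-odd e≤1+o rewrite e-even | o-odd = Equivalence.to T-≡ (≤⇒≤ᵇ e≤1+o)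

reaches-irrefl : ∀ a → reaches a a ≡ false
reaches-irrefl a with isEven a
... | true  = refl
... | false = refl

∨≡true⁻ : ∀ {a b} → a ∨ b ≡ true → (a ≡ true) ⊎ (b ≡ true)
∨≡true⁻ {true}  _ = inj₁ refl
∨≡true⁻ {false} b = inj₂ b

∨≡true⁺ˡ : ∀ {a} b → a ≡ true → a ∨ b ≡ true
∨≡true⁺ˡ _ refl = refl

∨≡true⁺ʳ : ∀ a {b} → b ≡ true → a ∨ b ≡ true
∨≡true⁺ʳ true  _ = refl
∨≡true⁺ʳ false b = b

-- A chain graph: the neighbourhoods of its even vertices are nested, so it has no induced 2K₂.
halfEdge : ℕ → ℕ → Bool
halfEdge a b = reaches a b ∨ reaches b a

halfGraph : ∀ n → Graph n
halfGraph n = record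
  { adj    = λ i j → halfEdge (toℕ i) (toℕ j)
  ; sym    = λ i j → ∨-comm (reaches (toℕ i) (toℕ j)) (reaches (toℕ j) (toℕ i))
  ; irrefl = λ i → subst (λ b → b ∨ b ≡ false) (≡-sym (reaches-irrefl (toℕ i))) refl
  }

halfEdge-suc : ∀ a → halfEdge a (suc a) ≡ true
halfEdge-suc a = by-parity (isEven a) refl
  where
  by-parity : ∀ b → isEven a ≡ b → halfEdge a (suc a) ≡ true
  by-parity true  a-even = ∨≡true⁺ˡ _ (reaches⁺ a-even (cong not a-even) (≤-trans (n≤1+n a) (n≤1+n (suc a))))
  by-parity false a-odd  = ∨≡true⁺ʳ (reaches a (suc a)) (reaches⁺ {suc a} {a} (cong not a-odd) a-odd ≤-refl)

halfGraph-hamiltonian : ∀ n → IsHamPath (halfGraph n) id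
halfGraph-hamiltonian n =
  id , λ i j j≡1+i → subst (λ b → halfEdge (toℕ i) b ≡ true) (≡-sym j≡1+i) (halfEdge-suc (toℕ i))

reaches-nested : ∀ e₁ o₁ e₂ o₂ → reaches e₁ o₁ ≡ true → reaches e₂ o₂ ≡ true →
                 (reaches e₁ o₂ ≡ true) ⊎ (reaches e₂ o₁ ≡ true)
reaches-nested e₁ o₁ e₂ o₂ r₁ r₂ with reaches⁻ e₁ o₁ r₁ | reaches⁻ e₂ o₂ r₂ | ≤-total o₁ o₂
... | ev₁ , od₁ , e₁≤ | _ , od₂ , _ | inj₁ o₁≤o₂ = inj₁ (reaches⁺ ev₁ od₂ (≤-trans e₁≤ (s≤s o₁≤o₂)))
... | _ , od₁ , _ | ev₂ , od₂ , e₂≤ | inj₂ o₂≤o₁ = inj₂ (reaches⁺ ev₂ od₁ (≤-trans e₂≤ (s≤s o₂≤o₁)))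

halfEdge-no2K₂ : ∀ a b c d → halfEdge a b ≡ true → halfEdge c d ≡ true →
                 (halfEdge a c ≡ true) ⊎ (halfEdge a d ≡ true) ⊎ (halfEdge b c ≡ true) ⊎ (halfEdge b d ≡ true)
halfEdge-no2K₂ a b c d ab cd with ∨≡true⁻ {reaches a b} ab | ∨≡true⁻ {reaches c d} cd
... | inj₁ r | inj₁ s with reaches-nested a b c d r s
...   | inj₁ t = inj₂ (inj₁ (∨≡true⁺ˡ (reaches d a) t))
...   | inj₂ t = inj₂ (inj₂ (inj₁ (∨≡true⁺ʳ (reaches b c) t)))
halfEdge-no2K₂ a b c d ab cd | inj₁ r | inj₂ s with reaches-nested a b d c r s
...   | inj₁ t = inj₁ (∨≡true⁺ˡ (reaches c a) t)
...   | inj₂ t = inj₂ (inj₂ (inj₂ (∨≡true⁺ʳ (reaches b d) t)))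
halfEdge-no2K₂ a b c d ab cd | inj₂ r | inj₁ s with reaches-nested b a c d r s
...   | inj₁ t = inj₂ (inj₂ (inj₂ (∨≡true⁺ˡ (reaches d b) t)))
...   | inj₂ t = inj₁ (∨≡true⁺ʳ (reaches a c) t)
halfEdge-no2K₂ a b c d ab cd | inj₂ r | inj₂ s with reaches-nested b a d c r s
...   | inj₁ t = inj₂ (inj₂ (inj₁ (∨≡true⁺ˡ (reaches c b) t)))
...   | inj₂ t = inj₂ (inj₁ (∨≡true⁺ʳ (reaches a d) t))

halfGraph-noInducedP₅ : ∀ n m → ¬ HasInducedPathOn (halfGraph n) (5 + m)
halfGraph-noInducedP₅ n m (f , _ , path) =
  Sum.[ apart v₀ v₃ (λ { (inj₁ ()) ; (inj₂ ()) }) , Sum.[ apart v₀ v₄ (λ { (inj₁ ()) ; (inj₂ ()) }) ,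
  Sum.[ apart v₁ v₃ (λ { (inj₁ ()) ; (inj₂ ()) }) , apart v₁ v₄ (λ { (inj₁ ()) ; (inj₂ ()) }) ] ] ]
    (halfEdge-no2K₂ (toℕ (f v₀)) (toℕ (f v₁)) (toℕ (f v₃)) (toℕ (f v₄))
      (proj₂ (path v₀ v₁) (inj₁ refl)) (proj₂ (path v₃ v₄) (inj₁ refl)))
  where
  v₀ v₁ v₃ v₄ : Fin (5 + m)
  v₀ = zero
  v₁ = suc zero
  v₃ = suc (suc (suc zero))
  v₄ = suc (suc (suc (suc zero)))
  apart : ∀ i j → ¬ Consecutive i j → ¬ halfEdge (toℕ (f i)) (toℕ (f j)) ≡ true
  apart i j i≁j e = i≁j (proj₁ (path i j) e)

halfGraph-inducedPath≤4 : ∀ n m → HasInducedPathOn (halfGraph n) m → m ≤ 4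
halfGraph-inducedPath≤4 n 0 _ = z≤n
halfGraph-inducedPath≤4 n 1 _ = s≤s z≤n
halfGraph-inducedPath≤4 n 2 _ = s≤s (s≤s z≤n)
halfGraph-inducedPath≤4 n 3 _ = s≤s (s≤s (s≤s z≤n))
halfGraph-inducedPath≤4 n 4 _ = s≤s (s≤s (s≤s (s≤s z≤n)))
halfGraph-inducedPath≤4 n (suc (suc (suc (suc (suc m))))) p = ⊥-elim (halfGraph-noInducedP₅ n m p)

strictlyMonotone⇒injective : ∀ {k n} (a : Fin k → Fin n) → (∀ i j → i <ᶠ j → a i <ᶠ a j) → Injective _≡_ _≡_ a
strictlyMonotone⇒injective a mono {i} {j} ai≡aj with Fin.<-cmp i j
... | tri< i<j _ _ = ⊥-elim (<-irrefl (cong toℕ ai≡aj) (mono i j i<j))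
... | tri≈ _ i≡j _ = i≡j
... | tri> _ _ j<i = ⊥-elim (<-irrefl (cong toℕ (≡-sym ai≡aj)) (mono j i j<i))

pattern-longEdge : ∀ {n k} {G : Graph n} {P : Fin n → Fin n} {H : Graph k} → ((a , _ , _) : ContainsPattern G P H) →
                   ∀ {i j} → i <ᶠ j → adj H i j ≡ true →
                   (adj G (P (a i)) (P (a j)) ≡ true) × (2 + toℕ (a i) ≤ toℕ (a j))
pattern-longEdge (a , mono , edges) {i} {j} i<j ij with edges i j ij
... | e , apart = e , ≤∧≢⇒< (mono i j i<j) (λ eq → apart (inj₁ (≡-sym eq)))

doubling : ∀ k → Graph (size k)
doubling k = record
  { adj    = λ i j → edge (vertexAt k i) (vertexAt k j)
  ; sym    = λ i j → edge-sym (vertexAt k i) (vertexAt k j)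
  ; irrefl = λ i → edge-irrefl (vertexAt k i)
  }

doubling-hamiltonian : ∀ k → IsHamPath (doubling k) id
doubling-hamiltonian k = id , λ i j j≡1+i → edge-successor (vertexAt k i) (vertexAt k j) (begin
  position (vertexAt k j)       ≡⟨ position-vertexAt k j ⟩
  toℕ j                         ≡⟨ j≡1+i ⟩
  suc (toℕ i)                   ≡⟨ cong suc (position-vertexAt k i) ⟨
  suc (position (vertexAt k i)) ∎)
  where open ≡-Reasoning

doubling-inducedPath : ∀ k m → HasInducedPathOn (doubling k) m → m ≤ rootedBound k + rootedBound k
doubling-inducedPath k m (f , f-injective , path) =
  subst (_≤ rootedBound k + rootedBound k) (length-tabulate (vertexAt k ∘ f))
    (inducedPath-length k (tabulate (vertexAt k ∘ f))
      (tabulate-isInducedPath (vertexAt k ∘ f) (f-injective ∘ vertexAt-injective k) path))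

doubling-avoids : ∀ {K} (H : Graph K) k {u v w} → u <ᶠ v → u <ᶠ w →
                  adj H u v ≡ true → adj H u w ≡ true → v ≢ w →
                  Avoids (doubling k) id H
doubling-avoids H k {u} u<v u<w uv uw v≢w c@(a , mono , _) =
  v≢w (strictlyMonotone⇒injective a mono (vertexAt-injective k (trans (to-parent u<v uv) (≡-sym (to-parent u<w uw)))))
  where
  to-parent : ∀ {x} → u <ᶠ x → adj H u x ≡ true → vertexAt k (a x) ≡ parent (vertexAt k (a u))
  to-parent {x} u<x ux with pattern-longEdge {G = doubling k} {P = id} {H = H} c u<x ux
  ... | e , gap = long-edge⇒parent _ _ e
        (subst₂ (λ p q → 2 + p ≤ q) (≡-sym (position-vertexAt k (a u))) (≡-sym (position-vertexAt k (a x))) gap)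

long-halfEdge⇒reaches : ∀ {x y} → halfEdge x y ≡ true → 2 + x ≤ y → reaches x y ≡ true
long-halfEdge⇒reaches {x} {y} xy gap with ∨≡true⁻ {reaches x y} xy
... | inj₁ r = r
... | inj₂ r = ⊥-elim (<⇒≱ gap (proj₂ (proj₂ (reaches⁻ y x r))))

halfGraph-avoids : ∀ {K} (H : Graph K) n {u l r} → l <ᶠ u → u <ᶠ r → adj H u l ≡ true → adj H u r ≡ true →
                   Avoids (halfGraph n) id H
halfGraph-avoids H n {u} {l} {r} l<u u<r ul ur c@(a , _ , _) = not-¬ u-odd u-even
  where
  backward = pattern-longEdge {G = halfGraph n} {P = id} {H = H} c l<u (trans (Graph.sym H l u) ul)
  forward  = pattern-longEdge {G = halfGraph n} {P = id} {H = H} c u<r ur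
  u-odd : isEven (toℕ (a u)) ≡ false
  u-odd = proj₁ (proj₂ (reaches⁻ (toℕ (a l)) (toℕ (a u)) (long-halfEdge⇒reaches (proj₁ backward) (proj₂ backward))))
  u-even : isEven (toℕ (a u)) ≡ true
  u-even = proj₁ (reaches⁻ (toℕ (a u)) (toℕ (a r)) (long-halfEdge⇒reaches (proj₁ forward) (proj₂ forward)))

-- Reversing the order

reverseGraph : ∀ {k} → Graph k → Graph k
reverseGraph H = record
  { adj    = λ i j → adj H (opposite i) (opposite j)
  ; sym    = λ i j → Graph.sym H (opposite i) (opposite j)
  ; irrefl = λ i → irrefl H (opposite i)
  }

toℕ-opposite+suc : ∀ {n} (i : Fin n) → toℕ (opposite i) + suc (toℕ i) ≡ n
toℕ-opposite+suc i = trans (cong (_+ suc (toℕ i)) (opposite-prop i)) (m∸n+n≡m (toℕ<n i))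

opposite-successor : ∀ {n} {i j : Fin n} → toℕ j ≡ suc (toℕ i) → toℕ (opposite i) ≡ suc (toℕ (opposite j))
opposite-successor {n} {i} {j} j≡1+i = +-cancelʳ-≡ (suc (toℕ i)) _ _ (begin
  toℕ (opposite i) + suc (toℕ i)       ≡⟨ toℕ-opposite+suc i ⟩
  n                                    ≡⟨ toℕ-opposite+suc j ⟨
  toℕ (opposite j) + suc (toℕ j)       ≡⟨ cong (λ t → toℕ (opposite j) + suc t) j≡1+i ⟩
  toℕ (opposite j) + suc (suc (toℕ i)) ≡⟨ +-suc (toℕ (opposite j)) (suc (toℕ i)) ⟩
  suc (toℕ (opposite j)) + suc (toℕ i) ∎)
  where open ≡-Reasoning

opposite-consecutive : ∀ {n} {i j : Fin n} → Consecutive (opposite i) (opposite j) → Consecutive i j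
opposite-consecutive {i = i} {j} (inj₁ c) =
  inj₂ (subst₂ (λ x y → toℕ x ≡ suc (toℕ y)) (opposite-involutive i) (opposite-involutive j) (opposite-successor c))
opposite-consecutive {i = i} {j} (inj₂ c) =
  inj₁ (subst₂ (λ x y → toℕ x ≡ suc (toℕ y)) (opposite-involutive j) (opposite-involutive i) (opposite-successor c))

opposite-< : ∀ {n} {i j : Fin n} → i <ᶠ j → opposite j <ᶠ opposite i
opposite-< {i = i} {j} i<j = ≰⇒> λ oi≤oj → <⇒≱ (s≤s i<j) (+-cancelˡ-≤ (toℕ (opposite j)) _ _ (begin
  toℕ (opposite j) + suc (toℕ j) ≡⟨ toℕ-opposite+suc j ⟩
  _                              ≡⟨ toℕ-opposite+suc i ⟨
  toℕ (opposite i) + suc (toℕ i) ≤⟨ +-monoˡ-≤ _ oi≤oj ⟩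
  toℕ (opposite j) + suc (toℕ i) ∎))
  where open ≤-Reasoning

isHamPath-opposite : ∀ {n} {G : Graph n} {P} → IsHamPath G P → IsHamPath G (P ∘ opposite)
isHamPath-opposite {G = G} {P} (P-injective , path) =
  P-injective′ , λ i j j≡1+i → trans (Graph.sym G _ _) (path (opposite j) (opposite i) (opposite-successor j≡1+i))
  where
  P-injective′ : Injective _≡_ _≡_ (P ∘ opposite)
  P-injective′ {i} {j} eq =
    trans (≡-sym (opposite-involutive i)) (trans (cong opposite (P-injective eq)) (opposite-involutive j))

containsPattern-opposite : ∀ {n k} {G : Graph n} {P} {H : Graph k} →
                           ContainsPattern G (P ∘ opposite) H → ContainsPattern G P (reverseGraph H)
containsPattern-opposite (a , mono , edges) =
  (opposite ∘ a ∘ opposite) ,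
  (λ i j i<j → opposite-< (mono _ _ (opposite-< i<j))) ,
  λ i j ij → proj₁ (edges _ _ ij) , λ c → proj₂ (edges _ _ ij) (opposite-consecutive c)

growsFasterThanLog-reverse : ∀ {k} {H : Graph k} → GrowsFasterThanLog H → GrowsFasterThanLog (reverseGraph H)
growsFasterThanLog-reverse {H = H} growth C with growth C
... | N , bound = N , λ n N≤n G P ham avoids →
  bound n N≤n G (P ∘ opposite) (isHamPath-opposite {G = G} ham) (avoids ∘ containsPattern-opposite {G = G} {P = P} {H = H})

ShortPathFamily : ∀ {k} → Graph k → ℕ → Set
ShortPathFamily H C =
  ∀ N → ∃[ m ] (N ≤ m × Σ (Graph m) λ G → Σ (Fin m → Fin m) λ P →
    IsHamPath G P × Avoids G P H × (∀ l → HasInducedPathOn G l → l < C * ⌊log₂ m ⌋))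

shortPathFamily⇒¬growsFasterThanLog : ∀ {k} (H : Graph k) C → ShortPathFamily H C → ¬ GrowsFasterThanLog H
shortPathFamily⇒¬growsFasterThanLog H C family growth with growth C
... | N , bound with family N
... | m , N≤m , G , P , ham , avoids , short with bound m N≤m G P ham avoids
... | l , t≤l , path = <⇒≱ (short l path) t≤l

<size : ∀ k → k < size k
<size zero    = s≤s z≤n
<size (suc k) = s≤s (≤-trans (<size k) (m≤m+n (size k) _))

2^≤size : ∀ k → 2 ^ k ≤ size k
2^≤size zero    = ≤-refl
2^≤size (suc k) = ≤-trans (+-mono-≤ (2^≤size k) (+-mono-≤ (2^≤size k) z≤n)) (n≤1+n _)

≤log₂size : ∀ k → k ≤ ⌊log₂ (size k) ⌋
≤log₂size k = subst (_≤ ⌊log₂ (size k) ⌋) (⌊log₂[2^n]⌋≡n k) (⌊log₂⌋-mono-≤ (2^≤size k))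

-- rootedBound k = 3k + 1, and 2 (3k + 1) < 7k once k ≥ 3.
twice-rootedBound< : ∀ j → rootedBound (3 + j) + rootedBound (3 + j) < 7 * (3 + j)
twice-rootedBound< zero    = ≤-refl
twice-rootedBound< (suc j) = begin-strict
  rootedBound (4 + j) + rootedBound (4 + j)       ≡⟨ cong (3 +_) (+-comm t (3 + t)) ⟩
  6 + (t + t)                                     <⟨ +-monoʳ-< 6 (twice-rootedBound< j) ⟩
  6 + 7 * (3 + j)                                 ≤⟨ n≤1+n _ ⟩
  7 + 7 * (3 + j)                                 ≡⟨ *-suc 7 (3 + j) ⟨
  7 * (4 + j)                                     ∎
  where
  open ≤-Reasoning
  t = rootedBound (3 + j)

doubling-family : ∀ {K} (H : Graph K) {u v w} → u <ᶠ v → u <ᶠ w →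
                  adj H u v ≡ true → adj H u w ≡ true → v ≢ w →
                  ShortPathFamily H 7
doubling-family H u<v u<w uv uw v≢w N =
  size (3 + N) , ≤-trans (m≤n+m N 3) (<⇒≤ (<size (3 + N))) ,
  doubling (3 + N) , id , doubling-hamiltonian (3 + N) , doubling-avoids H (3 + N) u<v u<w uv uw v≢w ,
  λ l path → ≤-trans (s≤s (doubling-inducedPath (3 + N) l path))
                     (≤-trans (twice-rootedBound< N) (*-monoʳ-≤ 7 (≤log₂size (3 + N))))

halfGraph-family : ∀ {K} (H : Graph K) {u l r} → l <ᶠ u → u <ᶠ r → adj H u l ≡ true → adj H u r ≡ true →
                   ShortPathFamily H 5
halfGraph-family H l<u u<r ul ur N =
  2 + N , m≤n+m N 2 , halfGraph (2 + N) , id , halfGraph-hamiltonian (2 + N) , halfGraph-avoids H (2 + N) l<u u<r ul ur ,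
  λ m path → ≤-trans (s≤s (halfGraph-inducedPath≤4 (2 + N) m path))
                     (*-monoʳ-≤ 5 (subst (_≤ ⌊log₂ (2 + N) ⌋) (⌊log₂[2^n]⌋≡n 1) (⌊log₂⌋-mono-≤ (m≤m+n 2 N))))

forwardCherry⇒¬growth : ∀ {K} (H : Graph K) {u v w} → u <ᶠ v → u <ᶠ w →
                        adj H u v ≡ true → adj H u w ≡ true → v ≢ w →
                        ¬ GrowsFasterThanLog H
forwardCherry⇒¬growth H u<v u<w uv uw v≢w =
  shortPathFamily⇒¬growsFasterThanLog H 7 (doubling-family H u<v u<w uv uw v≢w)

backwardCherry⇒¬growth : ∀ {K} (H : Graph K) {u v w} → v <ᶠ u → w <ᶠ u →
                         adj H u v ≡ true → adj H u w ≡ true → v ≢ w →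
                         ¬ GrowsFasterThanLog H
backwardCherry⇒¬growth H {u} {v} {w} v<u w<u uv uw v≢w growth =
  forwardCherry⇒¬growth (reverseGraph H) (opposite-< v<u) (opposite-< w<u) (reversed uv) (reversed uw)
    (λ eq → v≢w (trans (≡-sym (opposite-involutive v)) (trans (cong opposite eq) (opposite-involutive w))))
    (growsFasterThanLog-reverse {H = H} growth)
  where
  reversed : ∀ {x} → adj H u x ≡ true → adj (reverseGraph H) (opposite u) (opposite x) ≡ true
  reversed {x} ux = subst₂ (λ p q → adj H p q ≡ true) (≡-sym (opposite-involutive u)) (≡-sym (opposite-involutive x)) ux

splitCherry⇒¬growth : ∀ {K} (H : Graph K) {u l r} → l <ᶠ u → u <ᶠ r → adj H u l ≡ true → adj H u r ≡ true →
                      ¬ GrowsFasterThanLog H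
splitCherry⇒¬growth H l<u u<r ul ur = shortPathFamily⇒¬growsFasterThanLog H 5 (halfGraph-family H l<u u<r ul ur)

no-loop : ∀ {k} (H : Graph k) u → ¬ adj H u u ≡ true
no-loop H u = not-¬ (irrefl H u)

mainTheorem19 : ∀ {k : ℕ} (H : Graph k) → GrowsFasterThanLog H → MaxDegreeAtMostOne H
mainTheorem19 H growth u v w uv uw with v Fin.≟ w | Fin.<-cmp u v | Fin.<-cmp u w
... | yes v≡w | _              | _              = v≡w
... | no _    | tri≈ _ refl _  | _              = ⊥-elim (no-loop H u uv)
... | no _    | _              | tri≈ _ refl _  = ⊥-elim (no-loop H u uw)
... | no v≢w  | tri< u<v _ _   | tri< u<w _ _   = ⊥-elim (forwardCherry⇒¬growth H u<v u<w uv uw v≢w growth)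
... | no v≢w  | tri> _ _ v<u   | tri> _ _ w<u   = ⊥-elim (backwardCherry⇒¬growth H v<u w<u uv uw v≢w growth)
... | no _    | tri> _ _ v<u   | tri< u<w _ _   = ⊥-elim (splitCherry⇒¬growth H v<u u<w uv uw growth)
... | no _    | tri< u<v _ _   | tri> _ _ w<u   = ⊥-elim (splitCherry⇒¬growth H w<u u<v uw uv growth)
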